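{- Let $t$ be a natural number and let $\mathit{OPT}=\mathtt{And}(\mathtt{Timebound}(0,t,\mathtt{Or}(\mathtt{Give}(\mathtt{One}(\mathtt{USD})),\mathtt{Give}(\mathtt{One}(\mathtt{EUR})))),\ \mathtt{Timebound}(t+2,\mathit{INF},\mathtt{Scale}(1,\mathtt{One}(\mathtt{GBP}))))$. Let $c_{\mathit{OPT}}$ be a contract with primitive $\mathit{OPT}$ and issuer $I$. For all states $s,s'$ with $s$ consistent: if $O$ joins $c_{\mathit{OPT}}$ between $s$ and $s'$ at a time before $t$, then $O$ is the owner of every contract generated by $c_{\mathit{OPT}}$.
   Context: Model of the Findel language. Addresses, identifiers and times are natural numbers; $\mathit{INF}$ is a fixed natural-number constant representing infinity. Primitives: $\mathtt{Zero}$, $\mathtt{One}(cur)$, $\mathtt{Scale}(k,P)$, $\mathtt{ScaleObs}(a,P)$, $\mathtt{Give}(P)$, $\mathtt{And}(P_1,P_2)$, $\mathtt{Or}(P_1,P_2)$, $\mathtt{If}(a,P_1,P_2)$, $\mathtt{Timebound}(t_0,t_1,P)$. $\mathrm{query}(\mathcal{G},a,\tau)$ returns $\mathtt{None}$ or $\mathtt{Some}\ v$. A contract $c$ has fields $\mathit{id}(c)$, $\mathit{dsc}(c)$, $\mathit{prim}(c)$, $\mathit{issuer}(c)$, $\mathit{owner}(c)$, proposed owner $\mathit{po}(c)$, scale $\mathit{sc}(c)$; a description $d$ has $\mathit{id}(d),\mathit{prim}(d),\mathit{sc}(d),\mathit{vfrom}(d),\mathit{vuntil}(d)$. $\mathrm{execute}(P,sc,I,O,B,\tau,\mathcal{G},cid,did,n,L)$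 returns $\bot$ or $(B',C',n',L')$ (balance, generated contracts, fresh id, ledger): $\mathtt{Zero}\mapsto(B,[],n,L)$; $\mathtt{One}(cur)$ moves $sc$ units of $cur$ from $I$ to $O$, returns no contracts, fresh id $n+1$, and prepends the transaction (id $n$, contract $cid$, from $I$, to $O$, amount $sc$, currency $cur$, time $\tau$); $\mathtt{Scale}(k,P')$ executes $P'$ with scale $sc\cdot k$; $\mathtt{ScaleObs}(a,P')$ is $\bot$ on query failure, else executes $P'$ with scale $sc\cdot v$; $\mathtt{Give}(P')$ executes $P'$ with $I,O$ swapped; $\mathtt{And}(P_1,P_2)$ executes $P_1$ then $P_2$, threading balance, fresh id and ledger and concatenating generated contracts, $\bot$ if either fails; $\mathtt{If}(a,P_1,P_2)$ is $\bot$ on query failure, executes $P_2$ if the value is $0$, else $P_1$; $\mathtt{Timebound}(t_0,t_1,P')$ is $\bot$ if $t_1<\tau$, executes $P'$ if $t_0<\tau\le t_1$, else returns $(B,[c'],n+2,L)$ with $c'$ = (id $n+1$, description $did$, primitive $\mathtt{Timebound}(t_0,t_1,P')$, issuer $I$, owner $O$, proposed owner $O$, scale $sc$); $\mathtt{Or}(P_1,P_2)\mapsto(B,[c'],n+2,L)$ with $c'$ = (id $n+1$, description $did$, primitive $\mathtt{Or}(P_1,P_2)$, issuer $I$, owner $O$, proposed owner $O$, scale $sc$). A state is $s=\langle\mathcal{C},\mathcal{D},\mathcal{B},\tau,\mathcal{G},i,\mathcal{L},\mathtt{E}\rangle$ (contracts $\mathcal{C}(s)$, descriptions, balance, time $\mathit{time}(s)$,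 gateways, fresh id $\mathit{fresh}(s)$, ledger, events $\mathtt{E}(s)$: $\mathtt{Executed}\ j$, $\mathtt{Deleted}\ j$, $\mathtt{IssuedFor}\ a\ j$). Steps $s\curvearrowright s'$: [Issue] for $d\in\mathcal{D}$, addresses $I,O$: prepend contract (id $i$, description $\mathit{id}(d)$, primitive $\mathit{prim}(d)$, issuer $I$, owner $I$, proposed owner $O$, scale $\mathit{sc}(d)$), fresh id $i+1$, prepend $\mathtt{IssuedFor}\ O\ i$. [Join] for $c\in\mathcal{C}$, joining address $O$, with $\mathit{po}(c)\in\{O,0\}$, $\mathit{prim}(c)$ not an $\mathtt{Or}$, description $d$ of $c$ with $\mathit{vfrom}(d)\le\tau\le\mathit{vuntil}(d)$, and $\mathrm{execute}(\mathit{prim}(c),\mathit{sc}(c),\mathit{issuer}(c),O,\mathcal{B},\tau,\mathcal{G},\mathit{id}(c),\mathit{dsc}(c),i,\mathcal{L})=(\mathcal{B}',\mathcal{C}',i',\mathcal{L}')$: contracts become $(\mathcal{C}\setminus\{c\})\cup\mathcal{C}'$, balance $\mathcal{B}'$, fresh id $i'$, ledger $\mathcal{L}'$, prepend $\mathtt{Executed}\ \mathit{id}(c)$; the contracts in $\mathcal{C}'$ are the contracts generated by $c$. [Join Or] as Join with $\mathit{prim}(c)=\mathtt{Or}(P_1,P_2)$, executing a chosen $P\in\{P_1,P_2\}$. [Fail] under the proposed-owner and validity-time conditions, if the execution returns $\bot$: remove $c$, prepend $\mathtt{Deleted}\ \mathit{id}(c)$, generate no contracts. [Tick] time $\tau\mapsto\tau+1$.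 $\rightsquigarrow$ is the reflexive–transitive closure of $\curvearrowright$. A state $s$ is consistent if: (1) every $c\in\mathcal{C}(s)$ has $\mathit{fresh}(s)>\mathit{id}(c)$; (2) if $\mathtt{Executed}\ j$ or $\mathtt{Deleted}\ j$ is in $\mathtt{E}(s)$ then $\mathit{fresh}(s)>j$; (3) for $c\in\mathcal{C}(s)$ neither $\mathtt{Executed}\ \mathit{id}(c)$ nor $\mathtt{Deleted}\ \mathit{id}(c)$ is in $\mathtt{E}(s)$; (4) no $j$ has both in $\mathtt{E}(s)$. $O$ joins $c$ between $s_1$ and $s_2$ at time $\tau$ if there are states $s,s''$ with $s_1\rightsquigarrow s$, $s''\rightsquigarrow s_2$, $c\in\mathcal{C}(s)$, $\mathit{time}(s)=\tau$, and $s\curvearrowright s''$ is a Join, Join Or or Fail step on $c$ with joining address $O$ (so that $\mathtt{Executed}\ \mathit{id}(c)$ or $\mathtt{Deleted}\ \mathit{id}(c)$ is in $\mathtt{E}(s'')$). -}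

module Defs where

open import Data.Nat using (ℕ; zero; suc; _+_; _*_; _≤_; _<_; _<ᵇ_; _≡ᵇ_)
open import Data.Bool using (Bool; true; false; if_then_else_)
open import Data.Integer as ℤ using (ℤ; +_)
open import Data.Maybe using (Maybe; just; nothing)
open import Data.List using (List; []; _∷_; _++_)
open import Data.List.Membership.Propositional using (_∈_)
open import Data.Product using (_×_; _,_; Σ; ∃; ∃-syntax)
open import Data.Sum using (_⊎_)
open import Data.Empty using (⊥)
open import Data.Unit using (⊤)
open import Relation.Nullary using (¬_)
open import Relation.Binary.PropositionalEquality using (_≡_)
open import Relation.Binary.Construct.Closure.ReflexiveTransitive using (Star)

Address : Set
Address = ℕ

Id : Set
Id = ℕ

Time : Set
Time = ℕ

data Currency : Set where
  USD EUR GBP CHF JPY : Currency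

curCode : Currency → ℕ
curCode USD = 0
curCode EUR = 1
curCode GBP = 2
curCode CHF = 3
curCode JPY = 4

_==ᶜ_ : Currency → Currency → Bool
a ==ᶜ b = curCode a ≡ᵇ curCode b

data Primitive : Set where
  Zero     : Primitive
  One      : Currency → Primitive
  Scale    : ℕ → Primitive → Primitive
  ScaleObs : Address → Primitive → Primitive
  Give     : Primitive → Primitive
  And      : Primitive → Primitive → Primitive
  Or       : Primitive → Primitive → Primitive
  If       : Address → Primitive → Primitive → Primitive
  Timebound : Time → Time → Primitive → Primitive

IsOr : Primitive → Set
IsOr (Or _ _) = ⊤
IsOr _ = ⊥

Gateways : Set
Gateways = Address → Time → Maybe ℕ

query : Gateways → Address → Time → Maybe ℕ
query G a τ = G a τ

Balance : Set
Balance = Address → Currency → ℤ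

transfer : Balance → Address → Address → ℕ → Currency → Balance
transfer B I O amt cur a cur' =
  let b₁ = if (a ≡ᵇ I) ∧ (cur' ==ᶜ cur) then B a cur' ℤ.- (+ amt) else B a cur'
  in  if (a ≡ᵇ O) ∧ (cur' ==ᶜ cur) then b₁ ℤ.+ (+ amt) else b₁
  where open Data.Bool using (_∧_)

record Transaction : Set where
  constructor mkTx
  field
    txId     : Id
    txCid    : Id
    txFrom   : Address
    txTo     : Address
    txAmount : ℕ
    txCur    : Currency
    txTime   : Time

Ledger : Set
Ledger = List Transaction

record Contract : Set where
  constructor mkContract
  field
    id     : Id
    dsc    : Id
    prim   : Primitive
    issuer : Address
    owner  : Address
    po     : Address    -- proposed owner
    sc     : ℕ
open Contract public

record Description : Set where
  constructor mkDescription
  field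
    did    : Id
    dprim  : Primitive
    dsc'   : ℕ
    vfrom  : Time
    vuntil : Time
open Description public

Result : Set
Result = Balance × List Contract × ℕ × Ledger

execute : Primitive → ℕ → Address → Address → Balance → Time → Gateways
        → Id → Id → ℕ → Ledger → Maybe Result
execute Zero sc I O B τ G cid dsc n L = just (B , [] , n , L)
execute (One cur) sc I O B τ G cid dsc n L =
  just (transfer B I O sc cur , [] , suc n , mkTx n cid I O sc cur τ ∷ L)
execute (Scale k P) sc I O B τ G cid dsc n L =
  execute P (sc * k) I O B τ G cid dsc n L
execute (ScaleObs a P) sc I O B τ G cid dsc n L with query G a τ
... | nothing = nothing
... | just v  = execute P (sc * v) I O B τ G cid dsc n L
execute (Give P) sc I O B τ G cid dsc n L =
  execute P sc O I B τ G cid dsc n L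
execute (And P₁ P₂) sc I O B τ G cid dsc n L with execute P₁ sc I O B τ G cid dsc n L
... | nothing = nothing
... | just (B₁ , C₁ , n₁ , L₁) with execute P₂ sc I O B₁ τ G cid dsc n₁ L₁
...   | nothing = nothing
...   | just (B₂ , C₂ , n₂ , L₂) = just (B₂ , C₁ ++ C₂ , n₂ , L₂)
execute (Or P₁ P₂) sc I O B τ G cid dsc n L =
  just (B , mkContract (suc n) dsc (Or P₁ P₂) I O O sc ∷ [] , suc (suc n) , L)
execute (If a P₁ P₂) sc I O B τ G cid dsc n L with query G a τ
... | nothing = nothing
... | just zero    = execute P₂ sc I O B τ G cid dsc n L
... | just (suc _) = execute P₁ sc I O B τ G cid dsc n L
execute (Timebound t₀ t₁ P) sc I O B τ G cid dsc n L =
  if t₁ <ᵇ τ then nothing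
  else if t₀ <ᵇ τ then execute P sc I O B τ G cid dsc n L
  else just (B , mkContract (suc n) dsc (Timebound t₀ t₁ P) I O O sc ∷ [] , suc (suc n) , L)

data Event : Set where
  Executed : Id → Event
  Deleted  : Id → Event
  IssuedFor : Address → Id → Event

record State : Set where
  constructor mkState
  field
    contracts    : List Contract
    descriptions : List Description
    balance      : Balance
    time         : Time
    gateways     : Gateways
    fresh        : ℕ
    ledger       : Ledger
    events       : List Event
open State public

-- Steps.  The contract set is a list; removing c is modelled by
-- splitting the list as C₁ ++ c ∷ C₂.

JoinConditions : State → Contract → Address → Set
JoinConditions s c O =
  (po c ≡ O ⊎ po c ≡ 0) ×
  (∃[ d ] (d ∈ descriptions s × did d ≡ dsc c × vfrom d ≤ time s × time s ≤ vuntil d))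

exec : State → Contract → Primitive → Address → Maybe Result
exec s c P O = execute P (sc c) (issuer c) O (balance s) (time s) (gateways s)
                       (id c) (dsc c) (fresh s) (ledger s)

data JoinStep : State → Contract → Address → List Contract → State → Set where
  join : ∀ {C₁ C₂ D B τ G i L E c O B' C' i' L'} →
    let s = mkState (C₁ ++ c ∷ C₂) D B τ G i L E in
    JoinConditions s c O → ¬ IsOr (prim c) →
    exec s c (prim c) O ≡ just (B' , C' , i' , L') →
    JoinStep s c O C' (mkState (C₁ ++ C₂ ++ C') D B' τ G i' L' (Executed (id c) ∷ E))
  joinOr : ∀ {C₁ C₂ D B τ G i L E c O B' C' i' L' P₁ P₂ P} →
    let s = mkState (C₁ ++ c ∷ C₂) D B τ G i L E in
    JoinConditions s c O → prim c ≡ Or P₁ P₂ → (P ≡ P₁ ⊎ P ≡ P₂) →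
    exec s c P O ≡ just (B' , C' , i' , L') →
    JoinStep s c O C' (mkState (C₁ ++ C₂ ++ C') D B' τ G i' L' (Executed (id c) ∷ E))
  fail : ∀ {C₁ C₂ D B τ G i L E c O} →
    let s = mkState (C₁ ++ c ∷ C₂) D B τ G i L E in
    JoinConditions s c O → ¬ IsOr (prim c) →
    exec s c (prim c) O ≡ nothing →
    JoinStep s c O [] (mkState (C₁ ++ C₂) D B τ G i L (Deleted (id c) ∷ E))
  failOr : ∀ {C₁ C₂ D B τ G i L E c O P₁ P₂ P} →
    let s = mkState (C₁ ++ c ∷ C₂) D B τ G i L E in
    JoinConditions s c O → prim c ≡ Or P₁ P₂ → (P ≡ P₁ ⊎ P ≡ P₂) →
    exec s c P O ≡ nothing →
    JoinStep s c O [] (mkState (C₁ ++ C₂) D B τ G i L (Deleted (id c) ∷ E))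

data _↷_ : State → State → Set where
  issue : ∀ {C D B τ G i L E d I O} → d ∈ D →
    mkState C D B τ G i L E ↷
    mkState (mkContract i (did d) (dprim d) I I O (dsc' d) ∷ C) D B τ G (suc i) L
            (IssuedFor O i ∷ E)
  joinStep : ∀ {s c O C' s'} → JoinStep s c O C' s' → s ↷ s'
  tick : ∀ {C D B τ G i L E} →
    mkState C D B τ G i L E ↷ mkState C D B (suc τ) G i L E

_⇝_ : State → State → Set
_⇝_ = Star _↷_

Consistent : State → Set
Consistent s =
  (∀ c → c ∈ contracts s → id c < fresh s) ×
  (∀ j → (Executed j ∈ events s ⊎ Deleted j ∈ events s) → j < fresh s) ×
  (∀ c → c ∈ contracts s → ¬ (Executed (id c) ∈ events s) × ¬ (Deleted (id c) ∈ events s)) ×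
  (∀ j → ¬ (Executed j ∈ events s × Deleted j ∈ events s))

JoinsBetween : State → State → Contract → Address → Time → List Contract → Set
JoinsBetween s₁ s₂ c O τ gen =
  ∃[ s ] ∃[ s'' ] (s₁ ⇝ s × s'' ⇝ s₂ × c ∈ contracts s × time s ≡ τ
                   × JoinStep s c O gen s'')

-- The option contract OPT (INF is the fixed "infinity" constant)

OPT : ℕ → ℕ → Primitive
OPT INF t = And (Timebound 0 t (Or (Give (One USD)) (Give (One EUR))))
                (Timebound (t + 2) INF (Scale 1 (One GBP)))

module Submission where

-- Executing a primitive with owner O hands out new contracts only when
-- it defers: an `Or`, or a `Timebound` whose window has not opened yet, is
-- re-issued as a contract owned by O.  The only constructor that changes who
-- the owner is, is `Give`, which swaps issuer and owner.  Hence if every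
-- `Give` in a primitive sits either below an `Or` (never executed directly)
-- or above a sub-primitive that never defers, all contracts generated by its
-- execution are owned by O.

open import Defs
open import Data.Nat using (ℕ; _<_; _<ᵇ_; zero; suc)
open import Data.Bool using (true; false)
open import Data.List using (List; []; _∷_; _++_)
open import Data.List.Relation.Unary.All using (All; []; _∷_)
open import Data.List.Relation.Unary.All.Properties using (++⁺)
open import Data.Maybe using (Maybe; just; nothing)
open import Data.Product using (_×_; _,_)
open import Data.Unit using (⊤; tt)
open import Data.Empty using (⊥; ⊥-elim)
open import Relation.Nullary using (¬_)
open import Relation.Binary.PropositionalEquality using (_≡_; refl; sym; subst)

OwnedBy : Address → List Contract → Set
OwnedBy O C = All (λ c → owner c ≡ O) C

Generates : (List Contract → Set) → Maybe Result → Set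
Generates Q nothing                = ⊤
Generates Q (just (_ , C , _ , _)) = Q C

-- Primitives whose execution never defers, hence generates no contracts.
Immediate : Primitive → Set
Immediate Zero                = ⊤
Immediate (One _)             = ⊤
Immediate (Scale _ P)         = Immediate P
Immediate (ScaleObs _ P)      = Immediate P
Immediate (Give P)            = Immediate P
Immediate (And P₁ P₂)         = Immediate P₁ × Immediate P₂
Immediate (If _ P₁ P₂)        = Immediate P₁ × Immediate P₂
Immediate (Or _ _)            = ⊥
Immediate (Timebound _ _ _)   = ⊥

-- Primitives whose deferred contracts are all owned by the joining address:
-- a `Give` is allowed only above an immediate primitive, while the branches
-- of an `Or` are unrestricted because an `Or` is always deferred whole.
OwnerPreserving : Primitive → Set
OwnerPreserving Zero              = ⊤
OwnerPreserving (One _)           = ⊤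
OwnerPreserving (Scale _ P)       = OwnerPreserving P
OwnerPreserving (ScaleObs _ P)    = OwnerPreserving P
OwnerPreserving (Give P)          = Immediate P
OwnerPreserving (And P₁ P₂)       = OwnerPreserving P₁ × OwnerPreserving P₂
OwnerPreserving (If _ P₁ P₂)      = OwnerPreserving P₁ × OwnerPreserving P₂
OwnerPreserving (Or _ _)          = ⊤
OwnerPreserving (Timebound _ _ P) = OwnerPreserving P

generates-and : ∀ {Q : List Contract → Set} → (∀ {C₁ C₂} → Q C₁ → Q C₂ → Q (C₁ ++ C₂)) →
  ∀ P₁ P₂ {sc I O B τ G cid ds n L} →
  Generates Q (execute P₁ sc I O B τ G cid ds n L) →
  (∀ {B n L} → Generates Q (execute P₂ sc I O B τ G cid ds n L)) →
  Generates Q (execute (And P₁ P₂) sc I O B τ G cid ds n L)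
generates-and _++Q_ P₁ P₂ {sc} {I} {O} {B} {τ} {G} {cid} {ds} {n} {L} q₁ q₂
  with execute P₁ sc I O B τ G cid ds n L | q₁
... | nothing | _ = tt
... | just (B₁ , C₁ , n₁ , L₁) | q₁′
  with execute P₂ sc I O B₁ τ G cid ds n₁ L₁ | q₂ {B₁} {n₁} {L₁}
...   | nothing | _ = tt
...   | just _  | q₂′ = q₁′ ++Q q₂′

immediate-generates-nothing : ∀ P {sc I O B τ G cid ds n L} → Immediate P →
  Generates (_≡ []) (execute P sc I O B τ G cid ds n L)
immediate-generates-nothing Zero _ = refl
immediate-generates-nothing (One _) _ = refl
immediate-generates-nothing (Scale _ P) imm = immediate-generates-nothing P imm
immediate-generates-nothing (ScaleObs a P) {τ = τ} {G} imm with query G a τ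
... | nothing = tt
... | just _  = immediate-generates-nothing P imm
immediate-generates-nothing (Give P) imm = immediate-generates-nothing P imm
immediate-generates-nothing (And P₁ P₂) (imm₁ , imm₂) =
  generates-and (λ { refl refl → refl }) P₁ P₂
    (immediate-generates-nothing P₁ imm₁) (immediate-generates-nothing P₂ imm₂)
immediate-generates-nothing (If a P₁ P₂) {τ = τ} {G} (imm₁ , imm₂) with query G a τ
... | nothing      = tt
... | just zero    = immediate-generates-nothing P₂ imm₂
... | just (suc _) = immediate-generates-nothing P₁ imm₁

nothing-generated-owned : ∀ {O} r → Generates (_≡ []) r → Generates (OwnedBy O) r
nothing-generated-owned nothing               _    = tt
nothing-generated-owned (just (_ , _ , _ , _)) refl = []

owner-preserving-generates-owned : ∀ P {sc I O B τ G cid ds n L} → OwnerPreserving P →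
  Generates (OwnedBy O) (execute P sc I O B τ G cid ds n L)
owner-preserving-generates-owned Zero _ = []
owner-preserving-generates-owned (One _) _ = []
owner-preserving-generates-owned (Scale _ P) op = owner-preserving-generates-owned P op
owner-preserving-generates-owned (ScaleObs a P) {τ = τ} {G} op with query G a τ
... | nothing = tt
... | just _  = owner-preserving-generates-owned P op
owner-preserving-generates-owned (Give P) {sc} {I} {O} {B} {τ} {G} {cid} {ds} {n} {L} imm =
  nothing-generated-owned (execute P sc O I B τ G cid ds n L) (immediate-generates-nothing P imm)
owner-preserving-generates-owned (And P₁ P₂) (op₁ , op₂) =
  generates-and ++⁺ P₁ P₂
    (owner-preserving-generates-owned P₁ op₁) (owner-preserving-generates-owned P₂ op₂)
owner-preserving-generates-owned (If a P₁ P₂) {τ = τ} {G} (op₁ , op₂) with query G a τ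
... | nothing      = tt
... | just zero    = owner-preserving-generates-owned P₂ op₂
... | just (suc _) = owner-preserving-generates-owned P₁ op₁
owner-preserving-generates-owned (Or _ _) _ = refl ∷ []
owner-preserving-generates-owned (Timebound t₀ t₁ P) {τ = τ} op with t₁ <ᵇ τ | t₀ <ᵇ τ
... | true  | _     = tt
... | false | true  = owner-preserving-generates-owned P op
... | false | false = refl ∷ []

joinStep-generates-owned : ∀ {s c O gen s''} → JoinStep s c O gen s'' →
  OwnerPreserving (prim c) → ¬ IsOr (prim c) → OwnedBy O gen
joinStep-generates-owned {c = c} (join _ _ executed) op _ =
  subst (Generates (OwnedBy _)) executed (owner-preserving-generates-owned (prim c) op)
joinStep-generates-owned (joinOr _ isOr _ _) _ notOr = ⊥-elim (notOr (subst IsOr (sym isOr) tt))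
joinStep-generates-owned (fail _ _ _)        _ _     = []
joinStep-generates-owned (failOr _ _ _ _)    _ _     = []

-- OPT is owner-preserving: its `Give`s sit inside the `Or` branch.
opt-owner-preserving : ∀ INF t → OwnerPreserving (OPT INF t)
opt-owner-preserving INF t = tt , tt

-- Proposition 10.  The conclusion holds for a join at any time.
proposition10 : (INF t : ℕ) (I O : Address) (cOPT : Contract) (s s' : State)
    (τ : Time) (gen : List Contract) →
    prim cOPT ≡ OPT INF t → issuer cOPT ≡ I → Consistent s →
    JoinsBetween s s' cOPT O τ gen → τ < t →
    All (λ c → owner c ≡ O) gen
proposition10 INF t I O cOPT s s' τ gen isOPT _ _ (_ , _ , _ , _ , _ , _ , step) _ =
  joinStep-generates-owned step
    (subst OwnerPreserving (sym isOPT) (opt-owner-preserving INF t))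
    (subst (λ P → ¬ IsOr P) (sym isOPT) (λ ()))
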